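{- Let $q$ be an odd prime power with $q\ge5$, let $U$ be a subgroup of $\mathbb{F}_q^*$ of order $n\ge2$ generated by $\alpha$, and let $c\in\mathbb{F}_q^*$, $c\ne1$. Put $a=-1/\alpha$, $b=-ac$, and $\mathbf{O}_n=\{x_1,\ldots,x_n\}$ with $x_i=b\sum_{j=0}^{n-i}(-1/a)^{j+1}$ for $1\le i\le n$. Let $F:\mathbb{F}_q\to\mathbb{F}_q$ be defined by $F(\delta)=(a+1)\delta+b$ for $\delta\notin\mathbf{O}_n$, $F(x_i)=ax_{i-1}+x_i+b$ for $2\le i\le n$, and $F(x_1)=0$. Then $V_F=\mathbb{F}_q\setminus cU$.
   Context: $V_F=\{F(x):x\in\mathbb{F}_q\}$ denotes the value set of $F$, and $cU=\{cu:u\in U\}$. (Here $x_1=0$, $x_n=-b/a$, and $F=f+x$ where $f$ is the permutation with $f=g$ off $\mathbf{O}_n$, $f(x_i)=g(x_{i-1})$ for $i\ge2$, $f(x_1)=g(x_n)=0$, $g(x)=ax+b$; such $F$ form the class $\mathcal{F}_{q,n}$.) -}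

module Defs where

open import Level using (0ℓ)
open import Data.Nat as ℕ using (ℕ; zero; suc)
open import Data.Fin using (Fin)
open import Relation.Binary.PropositionalEquality using (_≡_; _≢_)
open import Algebra.Structures using (IsCommutativeRing)
open import Function.Bundles using (_↔_)

-- A finite field with exactly q elements, equality being propositional.
-- inv is a total inverse (inv 0 is unspecified), with x * inv x ≡ 1 for x ≢ 0.
record FiniteField (q : ℕ) : Set₁ where
  infixl 7 _*_
  infixl 6 _+_
  field
    Carrier : Set
    _+_ _*_ : Carrier → Carrier → Carrier
    -_      : Carrier → Carrier
    0# 1#   : Carrier
    inv     : Carrier → Carrier
    isCommutativeRing : IsCommutativeRing _≡_ _+_ _*_ -_ 0# 1#
    0≢1     : 0# ≢ 1#
    inverseʳ : ∀ x → x ≢ 0# → x * inv x ≡ 1#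
    enumeration : Carrier ↔ Fin q

  _^_ : Carrier → ℕ → Carrier
  x ^ zero  = 1#
  x ^ suc k = x * (x ^ k)

  sumTo : ℕ → (ℕ → Carrier) → Carrier
  sumTo zero    f = f zero
  sumTo (suc m) f = sumTo m f + f (suc m)

-- Put h δ = (a + 1)δ + b, a bijection of 𝔽_q because α ≠ 1; F agrees with h off 𝐎_n.
-- Since -1/a = α, each x_i is b times the geometric sum α + α² + ⋯ + α^(n-i+1), whence
-- h(x_i) = cα^(n-i), so h(𝐎_n) = cU, and a x_(i-1) + x_i + b = 0, so F collapses 𝐎_n to 0.
-- Hence V_F = h(𝔽_q ∖ 𝐎_n) ∪ {0} = 𝔽_q ∖ cU, as 0 ∉ cU.
module Submission where

open import Defs
open import Data.Nat using (ℕ; suc; _≤_; _<_; _∸_; _%_)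
open import Data.Nat.Primality using (Prime)
open import Data.Product using (∃; _×_; _,_)
open import Relation.Nullary using (¬_)
open import Relation.Binary.PropositionalEquality using (_≡_; _≢_)
open import Function.Bundles using (_⇔_)

open import Level using (0ℓ)
open import Data.Nat as ℕ using (zero; z≤n; s≤s; _/_; NonZero)
import Data.Nat.Properties as ℕ
open import Data.Nat.DivMod using (m≡m%n+[m/n]*n; m%n<n)
open import Relation.Binary.PropositionalEquality using (refl; sym; trans; subst; cong; cong₂; module ≡-Reasoning)
open import Algebra.Bundles using (CommutativeRing)
open import Function.Bundles using (mk⇔)

image-of-collapse : {A : Set} (h h⁻¹ : A → A) → (∀ {u v} → h u ≡ h v → u ≡ v) → (∀ y → h (h⁻¹ y) ≡ y) →
  (O C : A → Set) → (∀ {δ} → O δ → C (h δ)) → (∀ {y} → C y → ∃ λ δ → O δ × h δ ≡ y) →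
  (z : A) → ¬ C z → (F : A → A) → (∀ δ → ¬ O δ → F δ ≡ h δ) → (∀ δ → O δ → F δ ≡ z) →
  ∀ y → (∃ λ δ → F δ ≡ y) ⇔ (¬ C y)
image-of-collapse h h⁻¹ h-injective h∘h⁻¹ O C h[O]⊆C C⊆h[O] z z∉C F F-off F-on y = mk⇔ value∉C preimage
  where
  value∉C : (∃ λ δ → F δ ≡ y) → ¬ C y
  value∉C (δ , Fδ≡y) y∈C with C⊆h[O] y∈C
  ... | ε , ε∈O , hε≡y = δ∉O (subst O (h-injective hε≡hδ) ε∈O)
    where
    δ∉O : ¬ O δ
    δ∉O δ∈O = z∉C (subst C (trans (sym Fδ≡y) (F-on δ δ∈O)) y∈C)
    hε≡hδ : h ε ≡ h δ
    hε≡hδ = trans hε≡y (trans (sym Fδ≡y) (F-off δ δ∉O))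

  preimage : ¬ C y → ∃ λ δ → F δ ≡ y
  preimage y∉C = h⁻¹ y , trans (F-off (h⁻¹ y) h⁻¹y∉O) (h∘h⁻¹ y)
    where
    h⁻¹y∉O : ¬ O (h⁻¹ y)
    h⁻¹y∉O h⁻¹y∈O = y∉C (subst C (h∘h⁻¹ y) (h[O]⊆C h⁻¹y∈O))

module FieldProperties {q : ℕ} (K : FiniteField q) where
  open FiniteField K

  commutativeRing : CommutativeRing 0ℓ 0ℓ
  commutativeRing = record { isCommutativeRing = isCommutativeRing }

  open CommutativeRing commutativeRing public
    using (+-assoc; +-comm; *-assoc; *-comm; +-identityʳ; *-identityˡ; *-identityʳ;
           distribˡ; distribʳ; zeroˡ; zeroʳ; -‿inverseˡ; +-group; ring; commutativeSemiring)
  open import Algebra.Properties.Ring ring public using (-‿distribˡ-*; -‿distribʳ-*; -‿involutive)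
  open import Algebra.Properties.Group +-group public using (∙-cancelˡ; inverseʳ-unique; y≈x\\z)
  open import Algebra.Solver.Ring.NaturalCoefficients.Default commutativeSemiring public
  open ≡-Reasoning

  *≡1⇒≢0 : ∀ {u} v → u * v ≡ 1# → u ≢ 0#
  *≡1⇒≢0 {u} v uv≡1 u≡0 = 0≢1 (begin
    0#     ≡⟨ sym (zeroˡ v) ⟩
    0# * v ≡⟨ cong (_* v) (sym u≡0) ⟩
    u * v  ≡⟨ uv≡1 ⟩
    1#     ∎)

  inv-*-cancelˡ : ∀ {u} v → u ≢ 0# → inv u * (u * v) ≡ v
  inv-*-cancelˡ {u} v u≢0 = begin
    inv u * (u * v) ≡⟨ solve 3 (λ u i v → i :* (u :* v) := (u :* i) :* v) refl u (inv u) v ⟩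
    (u * inv u) * v ≡⟨ cong (_* v) (inverseʳ u u≢0) ⟩
    1# * v          ≡⟨ *-identityˡ v ⟩
    v               ∎

  *-cancelˡ : ∀ {u} v w → u ≢ 0# → u * v ≡ u * w → v ≡ w
  *-cancelˡ {u} v w u≢0 uv≡uw = begin
    v               ≡⟨ sym (inv-*-cancelˡ v u≢0) ⟩
    inv u * (u * v) ≡⟨ cong (inv u *_) uv≡uw ⟩
    inv u * (u * w) ≡⟨ inv-*-cancelˡ w u≢0 ⟩
    w               ∎

  *-≢0 : ∀ {u v} → u ≢ 0# → v ≢ 0# → u * v ≢ 0#
  *-≢0 {u} {v} u≢0 v≢0 uv≡0 = v≢0 (*-cancelˡ v 0# u≢0 (trans uv≡0 (sym (zeroʳ u))))

  inv-‿inv : ∀ {α} → α ≢ 0# → inv (- inv α) ≡ - α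
  inv-‿inv {α} α≢0 = *-cancelˡ (inv (- inv α)) (- α) -inv≢0 (trans (inverseʳ _ -inv≢0) (sym -inv*-α≡1))
    where
    -inv*-α≡1 : - inv α * - α ≡ 1#
    -inv*-α≡1 = begin
      - inv α * - α     ≡⟨ sym (-‿distribˡ-* (inv α) (- α)) ⟩
      - (inv α * - α)   ≡⟨ cong -_ (sym (-‿distribʳ-* (inv α) α)) ⟩
      - (- (inv α * α)) ≡⟨ -‿involutive _ ⟩
      inv α * α         ≡⟨ *-comm (inv α) α ⟩
      α * inv α         ≡⟨ inverseʳ α α≢0 ⟩
      1#                ∎
    -inv≢0 : - inv α ≢ 0#
    -inv≢0 = *≡1⇒≢0 (- α) -inv*-α≡1

  ^-distribˡ-+-* : ∀ α m p → α ^ (m ℕ.+ p) ≡ α ^ m * α ^ p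
  ^-distribˡ-+-* α zero    p = sym (*-identityˡ _)
  ^-distribˡ-+-* α (suc m) p = trans (cong (α *_) (^-distribˡ-+-* α m p)) (sym (*-assoc α (α ^ m) (α ^ p)))

  ^-≢0 : ∀ {α} → α ≢ 0# → ∀ k → α ^ k ≢ 0#
  ^-≢0 α≢0 zero    1≡0 = 0≢1 (sym 1≡0)
  ^-≢0 α≢0 (suc k)     = *-≢0 α≢0 (^-≢0 α≢0 k)

  ^≡^% : ∀ {α n} .{{_ : NonZero n}} → α ^ n ≡ 1# → ∀ k → α ^ k ≡ α ^ (k % n)
  ^≡^% {α} {n} αⁿ≡1 k = begin
    α ^ k                             ≡⟨ cong (α ^_) (m≡m%n+[m/n]*n k n) ⟩
    α ^ (k % n ℕ.+ k / n ℕ.* n)       ≡⟨ ^-distribˡ-+-* α (k % n) (k / n ℕ.* n) ⟩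
    α ^ (k % n) * α ^ (k / n ℕ.* n)   ≡⟨ cong (α ^ (k % n) *_) (^-multiple (k / n)) ⟩
    α ^ (k % n) * 1#                  ≡⟨ *-identityʳ _ ⟩
    α ^ (k % n)                       ∎
    where
    ^-multiple : ∀ d → α ^ (d ℕ.* n) ≡ 1#
    ^-multiple zero    = refl
    ^-multiple (suc d) = begin
      α ^ (n ℕ.+ d ℕ.* n)    ≡⟨ ^-distribˡ-+-* α n (d ℕ.* n) ⟩
      α ^ n * α ^ (d ℕ.* n)  ≡⟨ cong₂ _*_ αⁿ≡1 (^-multiple d) ⟩
      1# * 1#                ≡⟨ *-identityˡ 1# ⟩
      1#                     ∎

  geometricSum : Carrier → ℕ → Carrier
  geometricSum α m = sumTo m (λ j → α ^ suc j)

  module _ {α : Carrier} (α≢0 : α ≢ 0#) where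

    inv-*-geometricSum : ∀ m → inv α * geometricSum α m + α ^ suc m ≡ 1# + geometricSum α m
    inv-*-geometricSum zero    = cong (_+ α ^ 1) (inv-*-cancelˡ 1# α≢0)
    inv-*-geometricSum (suc m) = begin
      inv α * (G m + α ^ suc (suc m)) + α ^ suc (suc m)
        ≡⟨ cong (_+ α ^ suc (suc m)) (distribˡ (inv α) (G m) _) ⟩
      (inv α * G m + inv α * α ^ suc (suc m)) + α ^ suc (suc m)
        ≡⟨ cong (λ t → (inv α * G m + t) + α ^ suc (suc m)) (inv-*-cancelˡ _ α≢0) ⟩
      (inv α * G m + α ^ suc m) + α ^ suc (suc m)
        ≡⟨ cong (_+ α ^ suc (suc m)) (inv-*-geometricSum m) ⟩
      (1# + G m) + α ^ suc (suc m)
        ≡⟨ +-assoc 1# (G m) _ ⟩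
      1# + G (suc m) ∎
      where G = geometricSum α

    inv-*-geometricSum-suc : ∀ m → inv α * geometricSum α (suc m) ≡ 1# + geometricSum α m
    inv-*-geometricSum-suc m = begin
      inv α * (G m + α ^ suc (suc m))         ≡⟨ distribˡ (inv α) (G m) _ ⟩
      inv α * G m + inv α * α ^ suc (suc m)   ≡⟨ cong (inv α * G m +_) (inv-*-cancelˡ _ α≢0) ⟩
      inv α * G m + α ^ suc m                 ≡⟨ inv-*-geometricSum m ⟩
      1# + G m                                ∎
      where G = geometricSum α

  module Affine {u : Carrier} (u≢0 : u ≢ 0#) (v : Carrier) where

    affine : Carrier → Carrier
    affine δ = u * δ + v

    affine⁻¹ : Carrier → Carrier
    affine⁻¹ y = inv u * (y + - v)

    affine-injective : ∀ {δ ε} → affine δ ≡ affine ε → δ ≡ ε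
    affine-injective {δ} {ε} eq =
      *-cancelˡ δ ε u≢0 (∙-cancelˡ v _ _ (trans (+-comm v _) (trans eq (+-comm _ v))))

    affine∘affine⁻¹ : ∀ y → affine (affine⁻¹ y) ≡ y
    affine∘affine⁻¹ y = begin
      u * (inv u * (y + - v)) + v ≡⟨ cong (_+ v) (solve 3 (λ u i t → u :* (i :* t) := (u :* i) :* t) refl u (inv u) _) ⟩
      (u * inv u) * (y + - v) + v ≡⟨ cong (λ t → t * (y + - v) + v) (inverseʳ u u≢0) ⟩
      1# * (y + - v) + v          ≡⟨ cong (_+ v) (*-identityˡ _) ⟩
      (y + - v) + v               ≡⟨ +-assoc y (- v) v ⟩
      y + (- v + v)               ≡⟨ cong (y +_) (-‿inverseˡ v) ⟩
      y + 0#                      ≡⟨ +-identityʳ y ⟩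
      y                           ∎

module Orbit {q : ℕ} (K : FiniteField q) (n : ℕ) {α : FiniteField.Carrier K}
             (α≢0 : α ≢ FiniteField.0# K) (α≢1 : α ≢ FiniteField.1# K) (c : FiniteField.Carrier K) where
  open FiniteField K
  open FieldProperties K
  open ≡-Reasoning

  -- Literally the a, b and x of the statement, so that its hypotheses on F apply verbatim.
  a b : Carrier
  a = - inv α
  b = - (a * c)

  x : ℕ → Carrier
  x i = b * sumTo (n ∸ i) (λ j → (- inv a) ^ suc j)

  a+1≢0 : a + 1# ≢ 0#
  a+1≢0 a+1≡0 = α≢1 (begin
    α          ≡⟨ sym (*-identityʳ α) ⟩
    α * 1#     ≡⟨ cong (α *_) (trans (inverseʳ-unique a 1# a+1≡0) (-‿involutive (inv α))) ⟩
    α * inv α  ≡⟨ inverseʳ α α≢0 ⟩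
    1#         ∎)

  open Affine a+1≢0 b public

  x≡b*geometricSum : ∀ i → x i ≡ b * geometricSum α (n ∸ i)
  x≡b*geometricSum i = cong (λ β → b * geometricSum β (n ∸ i)) (trans (cong -_ (inv-‿inv α≢0)) (-‿involutive α))

  b*α^suc : ∀ k → b * α ^ suc k ≡ c * α ^ k
  b*α^suc k = begin
    - (- inv α * c) * α ^ suc k  ≡⟨ cong (λ t → - t * α ^ suc k) (sym (-‿distribˡ-* (inv α) c)) ⟩
    - (- (inv α * c)) * α ^ suc k ≡⟨ cong (_* α ^ suc k) (-‿involutive _) ⟩
    (inv α * c) * (α * α ^ k)    ≡⟨ solve 4 (λ i c a p → (i :* c) :* (a :* p) := c :* (i :* (a :* p))) refl (inv α) c α (α ^ k) ⟩
    c * (inv α * (α * α ^ k))    ≡⟨ cong (c *_) (inv-*-cancelˡ (α ^ k) α≢0) ⟩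
    c * α ^ k                    ∎

  a*[b*t] : ∀ t → a * (b * t) ≡ - (b * (inv α * t))
  a*[b*t] t = begin
    - inv α * (b * t)   ≡⟨ sym (-‿distribˡ-* (inv α) (b * t)) ⟩
    - (inv α * (b * t)) ≡⟨ cong -_ (solve 3 (λ i b t → i :* (b :* t) := b :* (i :* t)) refl (inv α) b t) ⟩
    - (b * (inv α * t)) ∎

  affine-b*geometricSum : ∀ m → affine (b * geometricSum α m) ≡ c * α ^ m
  affine-b*geometricSum m = begin
    (a + 1#) * t + b          ≡⟨ cong (_+ b) (distribʳ t a 1#) ⟩
    (a * t + 1# * t) + b      ≡⟨ cong₂ (λ u v → (u + v) + b) (a*[b*t] G) (*-identityˡ t) ⟩
    (- X + t) + b             ≡⟨ +-assoc (- X) t b ⟩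
    - X + (t + b)             ≡⟨ cong (- X +_) (+-comm t b) ⟩
    - X + (b + t)             ≡⟨ sym (y≈x\\z X (b * α ^ suc m) (b + t) X+bα^suc≡b+t) ⟩
    b * α ^ suc m             ≡⟨ b*α^suc m ⟩
    c * α ^ m                 ∎
    where
    G = geometricSum α m
    t = b * G
    X = b * (inv α * G)
    X+bα^suc≡b+t : X + b * α ^ suc m ≡ b + t
    X+bα^suc≡b+t = begin
      b * (inv α * G) + b * α ^ suc m ≡⟨ sym (distribˡ b _ _) ⟩
      b * (inv α * G + α ^ suc m)     ≡⟨ cong (b *_) (inv-*-geometricSum α≢0 m) ⟩
      b * (1# + G)                    ≡⟨ distribˡ b 1# G ⟩
      b * 1# + t                      ≡⟨ cong (_+ t) (*-identityʳ b) ⟩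
      b + t                           ∎

  orbit-recurrence : ∀ m → a * (b * geometricSum α (suc m)) + b * geometricSum α m + b ≡ 0#
  orbit-recurrence m = begin
    a * (b * geometricSum α (suc m)) + t + b   ≡⟨ cong (λ u → u + t + b) (a*[b*t] (geometricSum α (suc m))) ⟩
    - (b * (inv α * geometricSum α (suc m))) + t + b
      ≡⟨ cong (λ u → - (b * u) + t + b) (inv-*-geometricSum-suc α≢0 m) ⟩
    - (b * (1# + geometricSum α m)) + t + b    ≡⟨ cong (λ u → - u + t + b) (trans (distribˡ b 1# _) (cong (_+ t) (*-identityʳ b))) ⟩
    - (b + t) + t + b                          ≡⟨ +-assoc (- (b + t)) t b ⟩
    - (b + t) + (t + b)                        ≡⟨ cong (- (b + t) +_) (+-comm t b) ⟩
    - (b + t) + (b + t)                        ≡⟨ -‿inverseˡ (b + t) ⟩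
    0#                                         ∎
    where t = b * geometricSum α m

  affine-x : ∀ i → affine (x i) ≡ c * α ^ (n ∸ i)
  affine-x i = trans (cong affine (x≡b*geometricSum i)) (affine-b*geometricSum (n ∸ i))

  collapse-on-orbit : (F : Carrier → Carrier) →
    (∀ i → 2 ≤ i → i ≤ n → F (x i) ≡ a * x (i ∸ 1) + x i + b) → F (x 1) ≡ 0# →
    ∀ i → 1 ≤ i → i ≤ n → F (x i) ≡ 0#
  collapse-on-orbit F F-on F-x₁ (suc zero)    _ _      = F-x₁
  collapse-on-orbit F F-on F-x₁ (suc (suc i)) _ i+2≤n = begin
    F (x (2 ℕ.+ i))                          ≡⟨ F-on (2 ℕ.+ i) (s≤s (s≤s z≤n)) i+2≤n ⟩
    a * x (suc i) + x (2 ℕ.+ i) + b          ≡⟨ cong₂ (λ u v → a * u + v + b) x[1+i] (x≡b*geometricSum (2 ℕ.+ i)) ⟩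
    a * (b * G (suc m)) + b * G m + b        ≡⟨ orbit-recurrence m ⟩
    0#                                       ∎
    where
    G = geometricSum α
    m = n ∸ (2 ℕ.+ i)
    x[1+i] : x (suc i) ≡ b * G (suc m)
    x[1+i] = trans (x≡b*geometricSum (suc i)) (cong (λ k → b * G k) (ℕ.+-∸-assoc 1 i+2≤n))

  OnOrbit : Carrier → Set
  OnOrbit δ = ∃ λ i → 1 ≤ i × i ≤ n × δ ≡ x i

  InCoset : Carrier → Set
  InCoset y = ∃ λ k → y ≡ c * α ^ k

  affine[orbit]⊆coset : ∀ {δ} → OnOrbit δ → InCoset (affine δ)
  affine[orbit]⊆coset (i , _ , _ , δ≡xᵢ) = n ∸ i , trans (cong affine δ≡xᵢ) (affine-x i)

  coset⊆affine[orbit] : .{{_ : NonZero n}} → α ^ n ≡ 1# → ∀ {y} → InCoset y → ∃ λ δ → OnOrbit δ × affine δ ≡ y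
  coset⊆affine[orbit] αⁿ≡1 (k , y≡cαᵏ) = x (n ∸ r) , (n ∸ r , 1≤n∸r , ℕ.m∸n≤m n r , refl) , (begin
    affine (x (n ∸ r))    ≡⟨ affine-x (n ∸ r) ⟩
    c * α ^ (n ∸ (n ∸ r)) ≡⟨ cong (λ j → c * α ^ j) (ℕ.m∸[m∸n]≡n (ℕ.<⇒≤ r<n)) ⟩
    c * α ^ r             ≡⟨ cong (c *_) (sym (^≡^% αⁿ≡1 k)) ⟩
    c * α ^ k             ≡⟨ sym y≡cαᵏ ⟩
    _                     ∎)
    where
    r = k % n
    r<n : r < n
    r<n = m%n<n k n
    1≤n∸r : 1 ≤ n ∸ r
    1≤n∸r = ℕ.m<n⇒0<n∸m r<n

  0∉coset : c ≢ 0# → ¬ InCoset 0#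
  0∉coset c≢0 (k , 0≡cαᵏ) = *-≢0 c≢0 (^-≢0 α≢0 k) (sym 0≡cαᵏ)

theorem11 : (q : ℕ) → (∃ λ p → ∃ λ k → Prime p × q ≡ Data.Nat._^_ p k) → q % 2 ≡ 1 → 5 ≤ q →
    (K : FiniteField q) → let open FiniteField K in
    (n : ℕ) → 2 ≤ n → (α : Carrier) → α ^ n ≡ 1# → (∀ k → 1 ≤ k → k < n → α ^ k ≢ 1#) →
    (c : Carrier) → c ≢ 0# → c ≢ 1# →
    let a = - inv α
        b = - (a * c)
        x : ℕ → Carrier
        x i = b * sumTo (n ∸ i) (λ j → (- inv a) ^ suc j)
    in (F : Carrier → Carrier) →
       (∀ δ → (∀ i → 1 ≤ i → i ≤ n → δ ≢ x i) → F δ ≡ (a + 1#) * δ + b) →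
       (∀ i → 2 ≤ i → i ≤ n → F (x i) ≡ a * x (i ∸ 1) + x i + b) →
       F (x 1) ≡ 0# →
       ∀ y → (∃ λ δ → F δ ≡ y) ⇔ (¬ (∃ λ k → y ≡ c * α ^ k))
theorem11 q _ _ _ K n@(suc n-1) (s≤s 1≤n-1) α αⁿ≡1 α-order c c≢0 _ F F-off F-on F-x₁ =
  image-of-collapse affine affine⁻¹ affine-injective affine∘affine⁻¹ OnOrbit InCoset
    affine[orbit]⊆coset (coset⊆affine[orbit] αⁿ≡1) 0# (0∉coset c≢0) F
    (λ δ δ∉orbit → F-off δ (λ i 1≤i i≤n δ≡xᵢ → δ∉orbit (i , 1≤i , i≤n , δ≡xᵢ)))
    (λ { δ (i , 1≤i , i≤n , δ≡xᵢ) → trans (cong F δ≡xᵢ) (collapse-on-orbit F F-on F-x₁ i 1≤i i≤n) })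
  where
  open FiniteField K
  open FieldProperties K using (*≡1⇒≢0; *-identityʳ)
  α≢0 : α ≢ 0#
  α≢0 = *≡1⇒≢0 (α ^ n-1) αⁿ≡1
  α≢1 : α ≢ 1#
  α≢1 α≡1 = α-order 1 (s≤s z≤n) (s≤s 1≤n-1) (trans (*-identityʳ α) α≡1)
  open Orbit K n α≢0 α≢1 c
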